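{- Let $t\ge 0$. The set of $t$-band permutations in $S_n$ is a strong up-set.
   Context: Elements of $S_n$ are $n$-tuples $\mathbf{a}=(a_1,\dots,a_n)$ of distinct elements of $[n]$; $\mathrm{pos}(\mathbf{a},i)=k$ if $a_k=i$. For $1\le i<j\le n$, $\{i,j\}$ is an inversion of $\mathbf{a}$ if $\mathrm{pos}(\mathbf{a},i)>\mathrm{pos}(\mathbf{a},j)$. A family $\mathcal{A}\subset S_n$ is a strong up-set if whenever $\mathbf{a}\in\mathcal{A}$ and $\{i,j\}$ is an inversion of $\mathbf{a}$, the permutation obtained by swapping the entries $i$ and $j$ is in $\mathcal{A}$. The displacement of $i$ in $\mathbf{a}$ is $\mathrm{disp}(\mathbf{a},i)=|i-\mathrm{pos}(\mathbf{a},i)|$, and $\mathbf{a}$ is a $t$-band permutation if $\mathrm{disp}(\mathbf{a},i)\le t$ for all $i\in[n]$. -}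

module Defs where

open import Data.Nat.Base using (ℕ; ∣_-_∣) renaming (_≤_ to _≤ℕ_)
open import Data.Fin.Base using (Fin; toℕ; _<_)
open import Data.Fin.Permutation using (Permutation′; _⟨$⟩ʳ_; _⟨$⟩ˡ_; _∘ₚ_; transpose)

-- A permutation a ∈ S_n is a bijection Fin n ↔ Fin n; a_k = a ⟨$⟩ʳ k
-- (positions and values are 0-indexed, i.e. [n] is shifted to {0,…,n-1}).

pos : ∀ {n} → Permutation′ n → Fin n → Fin n
pos a i = a ⟨$⟩ˡ i

-- The permutation obtained from a by swapping the entries i and j:
-- its k-th entry is τ(a_k), where τ is the transposition (i j).
swapEntries : ∀ {n} → Permutation′ n → Fin n → Fin n → Permutation′ n
swapEntries a i j = a ∘ₚ transpose i j

Family : ℕ → Set₁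
Family n = Permutation′ n → Set

StrongUpSet : ∀ {n} → Family n → Set
StrongUpSet {n} A =
  ∀ (a : Permutation′ n) (i j : Fin n) →
  A a → i < j → pos a j < pos a i → A (swapEntries a i j)

disp : ∀ {n} → Permutation′ n → Fin n → ℕ
disp a i = ∣ toℕ i - toℕ (pos a i) ∣

IsBand : ∀ {n} → ℕ → Permutation′ n → Set
IsBand t a = ∀ i → disp a i ≤ℕ t

module Submission where

-- Swapping the entries of an inversion i < j replaces the matching
-- i ↦ q, j ↦ p of values to positions (p < q) by the uncrossed matching
-- i ↦ p, j ↦ q.  Since i ≤ j ≤ p + t and p ≤ q ≤ i + t, and similarly for
-- j and q, the new displacements stay within the old bound t; all other
-- entries keep their positions.

open import Defs
open import Data.Nat.Base using (ℕ; zero; suc; s≤s; _+_; _≤_; ∣_-_∣)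
open import Data.Nat.Properties
  using (≤-trans; <⇒≤; +-monoʳ-≤; +-monoˡ-≤; m≤n+∣m-n∣; ∣-∣-comm)
open import Data.Fin.Base using (Fin; toℕ)
open import Data.Fin.Properties using (_≟_)
open import Data.Fin.Permutation using (Permutation′)
import Data.Fin.Permutation.Components as PC
open import Data.Product using (_×_; _,_)
open import Relation.Binary.PropositionalEquality using (_≡_; _≢_; refl; subst)
open import Relation.Nullary using (yes; no)

∣m-n∣≤o⇒m≤n+o : ∀ m n {o} → ∣ m - n ∣ ≤ o → m ≤ n + o
∣m-n∣≤o⇒m≤n+o m n ∣m-n∣≤o = ≤-trans (m≤n+∣m-n∣ m n) (+-monoʳ-≤ n ∣m-n∣≤o)

∣m-n∣≤o⇒n≤m+o : ∀ m n {o} → ∣ m - n ∣ ≤ o → n ≤ m + o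
∣m-n∣≤o⇒n≤m+o m n ∣m-n∣≤o = ∣m-n∣≤o⇒m≤n+o n m (subst (_≤ _) (∣-∣-comm m n) ∣m-n∣≤o)

m≤n+o⇒n≤m+o⇒∣m-n∣≤o : ∀ m n {o} → m ≤ n + o → n ≤ m + o → ∣ m - n ∣ ≤ o
m≤n+o⇒n≤m+o⇒∣m-n∣≤o zero    n       _           n≤o         = n≤o
m≤n+o⇒n≤m+o⇒∣m-n∣≤o (suc m) zero    m≤o         _           = m≤o
m≤n+o⇒n≤m+o⇒∣m-n∣≤o (suc m) (suc n) (s≤s m≤n+o) (s≤s n≤m+o) =
  m≤n+o⇒n≤m+o⇒∣m-n∣≤o m n m≤n+o n≤m+o

∣-∣≤-uncross : ∀ {i j p q t} → i ≤ j → p ≤ q →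
               ∣ i - q ∣ ≤ t → ∣ j - p ∣ ≤ t → ∣ i - p ∣ ≤ t × ∣ j - q ∣ ≤ t
∣-∣≤-uncross {i} {j} {p} {q} i≤j p≤q ∣i-q∣≤t ∣j-p∣≤t =
  m≤n+o⇒n≤m+o⇒∣m-n∣≤o i p (≤-trans i≤j j≤p+t) (≤-trans p≤q q≤i+t) ,
  m≤n+o⇒n≤m+o⇒∣m-n∣≤o j q (≤-trans j≤p+t (+-monoˡ-≤ _ p≤q)) (≤-trans q≤i+t (+-monoˡ-≤ _ i≤j))
  where
  j≤p+t = ∣m-n∣≤o⇒m≤n+o j p ∣j-p∣≤t
  q≤i+t = ∣m-n∣≤o⇒n≤m+o i q ∣i-q∣≤t

transpose-elim : ∀ {n} (P : Fin n → Set) {i j k : Fin n} →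
                 (k ≡ i → P j) → (k ≡ j → P i) → (k ≢ i → k ≢ j → P k) →
                 P (PC.transpose i j k)
transpose-elim P {i} {j} {k} at-i at-j elsewhere with k ≟ i
... | yes k≡i = at-i k≡i
... | no k≢i with k ≟ j
...   | yes k≡j = at-j k≡j
...   | no k≢j  = elsewhere k≢i k≢j

-- pos (swapEntries a i j) k reduces to pos a (PC.transpose j i k).
IsBand-swapEntries : ∀ {n t} (a : Permutation′ n) {i j : Fin n} → IsBand t a →
                     ∣ toℕ i - toℕ (pos a j) ∣ ≤ t → ∣ toℕ j - toℕ (pos a i) ∣ ≤ t →
                     IsBand t (swapEntries a i j)
IsBand-swapEntries {t = t} a band disp′i≤t disp′j≤t k =
  transpose-elim (λ l → ∣ toℕ k - toℕ (pos a l) ∣ ≤ t)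
    (λ { refl → disp′j≤t }) (λ { refl → disp′i≤t }) (λ _ _ → band k)

lemma6 : (t n : ℕ) → StrongUpSet {n} (IsBand t)
lemma6 t n a i j band i<j pos-j<pos-i =
  let disp′i≤t , disp′j≤t = ∣-∣≤-uncross (<⇒≤ i<j) (<⇒≤ pos-j<pos-i) (band i) (band j)
  in IsBand-swapEntries a band disp′i≤t disp′j≤t
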